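{- Let $m\geq 1$ and $n\geq 0$ be integers and let $s$ be an integer. Then $$\sum_{r=1}^{m}\mathcal{T}^*_{r,m}(n)\,\mathcal{T}^*_{r+s,m}(n)=(-1)^n\,\mathcal{T}^*_{n+s,m}(2n).$$
   Context: For integers $r$, $m\geq 1$, $n\geq 0$ define $\mathcal{T}^*_{r,m}(n)=\sum_{0\leq k\leq n,\ k\equiv r\pmod m}(-1)^k\binom{n}{k}$. -}

module Defs where

open import Data.Nat as ℕ using (ℕ; zero; suc; NonZero)
open import Data.Nat.Combinatorics using (_C_)
open import Data.Integer as ℤ using (ℤ; +_; _-_; -_)
open import Data.Integer.DivMod using (_%ℕ_)
open import Data.Integer using (_+_; _*_)
open import Relation.Nullary.Decidable using (Dec; yes; no)
open import Relation.Binary.PropositionalEquality using (_≡_)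

sign : ℕ → ℤ
sign zero = + 1
sign (suc k) = - sign k

sumTo : ℕ → (ℕ → ℤ) → ℤ
sumTo zero f = f 0
sumTo (suc n) f = sumTo n f + f (suc n)

congDec : (m : ℕ) .{{_ : NonZero m}} (k : ℕ) (r : ℤ) → Dec (((+ k) - r) %ℕ m ≡ 0)
congDec m k r = ((+ k) - r) %ℕ m ℕ.≟ 0

-- T*_{r,m}(n) = Σ_{0 ≤ k ≤ n, k ≡ r (mod m)} (-1)^k C(n,k)
Tstar : (r : ℤ) (m : ℕ) .{{_ : NonZero m}} (n : ℕ) → ℤ
Tstar r m n = sumTo n λ k → term k (congDec m k r)
  where
  term : (k : ℕ) → Dec (((+ k) - r) %ℕ m ≡ 0) → ℤ
  term k (yes _) = sign k * + (n C k)
  term k (no _)  = + 0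

sumFrom1 : ℕ → (ℕ → ℤ) → ℤ
sumFrom1 zero f = + 0
sumFrom1 (suc m) f = sumFrom1 m f + f (suc m)

module Submission where

-- Write a_k = (-1)^k C(n,k) and [j ≡ r] for the indicator of j ≡ r (mod m).
-- Expanding both factors of  Σ_r T*_{r,m}(n) T*_{r+s,m}(n)  gives
--
--   Σ_r Σ_j Σ_k [j ≡ r] [k ≡ r + s] a_j a_k  =  Σ_j Σ_k a_j a_k [k ≡ j + s],
--
-- because r = 1, …, m is a complete residue system (orthogonality).  Replacing
-- j by n - j turns a_{n-j} into (-1)^n (-1)^j C(n,j) and the condition into
-- j + k ≡ n + s, so the double sum is (-1)^n Σ_j Σ_k C(n,j) C(n,k) f(j + k) with
-- f(t) = (-1)^t [t ≡ n + s].  The Vandermonde convolution collapses this to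
-- (-1)^n Σ_t C(2n,t) f(t) = (-1)^n T*_{n+s,m}(2n).

open import Defs
open import Data.Nat using (ℕ; NonZero)
import Data.Nat
open import Data.Nat as ℕ using (zero; suc; _≤_; _<_; z≤n; s≤s)
import Data.Nat.Properties as ℕP
open import Data.Nat.Combinatorics
  using (_C_; nCk+nC[k+1]≡[n+1]C[k+1]; k>n⇒nCk≡0; nCk≡nC[n∸k])
import Data.Nat.Divisibility as ℕD
open import Data.Nat.DivMod using (m<n⇒m%n≡m)
open import Data.Integer using (ℤ; +_; _+_; _*_; -_; _-_; _⊖_; ∣_∣; _%ℕ_; _/ℕ_)
import Data.Integer.Properties as ℤP
open import Data.Integer.DivMod using (n%ℕd<d; a≡a%ℕn+[a/ℕn]*n)
open import Data.Integer.Divisibility.Signed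
  using (_∣_; divides; _∣?_; ∣-refl; ∣⇒∣ᵤ; ∣m∣n⇒∣m+n; ∣m∣n⇒∣m-n; ∣n⇒∣m*n)
open import Data.Integer.Tactic.RingSolver using (solve-∀)
open import Function using (_∘_)
open import Data.Empty using (⊥-elim)
open import Relation.Nullary using (Dec; yes; no; ¬_)
open import Relation.Binary.PropositionalEquality
open ≡-Reasoning

sumTo-cong≤ : ∀ n {f g : ℕ → ℤ} → (∀ k → k ≤ n → f k ≡ g k) → sumTo n f ≡ sumTo n g
sumTo-cong≤ zero    f≡g = f≡g 0 z≤n
sumTo-cong≤ (suc n) f≡g =
  cong₂ _+_ (sumTo-cong≤ n (λ k k≤n → f≡g k (ℕP.m≤n⇒m≤1+n k≤n))) (f≡g (suc n) ℕP.≤-refl)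

sumTo-cong : ∀ n {f g : ℕ → ℤ} → (∀ k → f k ≡ g k) → sumTo n f ≡ sumTo n g
sumTo-cong n f≡g = sumTo-cong≤ n (λ k _ → f≡g k)

sumTo-+ : ∀ n (f g : ℕ → ℤ) → sumTo n (λ k → f k + g k) ≡ sumTo n f + sumTo n g
sumTo-+ zero    f g = refl
sumTo-+ (suc n) f g =
  trans (cong (_+ (f (suc n) + g (suc n))) (sumTo-+ n f g))
        (interchange (sumTo n f) (sumTo n g) (f (suc n)) (g (suc n)))
  where
  interchange : ∀ a b c d → (a + b) + (c + d) ≡ (a + c) + (b + d)
  interchange = solve-∀

sumTo-*ˡ : ∀ n x (f : ℕ → ℤ) → sumTo n (λ k → x * f k) ≡ x * sumTo n f
sumTo-*ˡ zero    x f = refl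
sumTo-*ˡ (suc n) x f =
  trans (cong (_+ x * f (suc n)) (sumTo-*ˡ n x f))
        (sym (ℤP.*-distribˡ-+ x (sumTo n f) (f (suc n))))

sumTo-*ʳ : ∀ n x (f : ℕ → ℤ) → sumTo n (λ k → f k * x) ≡ sumTo n f * x
sumTo-*ʳ n x f = begin
  sumTo n (λ k → f k * x) ≡⟨ sumTo-cong n (λ k → ℤP.*-comm (f k) x) ⟩
  sumTo n (λ k → x * f k) ≡⟨ sumTo-*ˡ n x f ⟩
  x * sumTo n f           ≡⟨ ℤP.*-comm x (sumTo n f) ⟩
  sumTo n f * x           ∎

sumTo-product : ∀ n p (f g : ℕ → ℤ) →
  sumTo n f * sumTo p g ≡ sumTo n (λ j → sumTo p (λ k → f j * g k))
sumTo-product n p f g =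
  trans (sym (sumTo-*ʳ n (sumTo p g) f)) (sumTo-cong n (λ j → sym (sumTo-*ˡ p (f j) g)))

sumTo-swap : ∀ n p (f : ℕ → ℕ → ℤ) →
  sumTo n (λ j → sumTo p (λ k → f j k)) ≡ sumTo p (λ k → sumTo n (λ j → f j k))
sumTo-swap zero    p f = refl
sumTo-swap (suc n) p f =
  trans (cong (_+ sumTo p (f (suc n))) (sumTo-swap n p f))
        (sym (sumTo-+ p (λ k → sumTo n (λ j → f j k)) (f (suc n))))

sumTo-shift : ∀ n (f : ℕ → ℤ) → sumTo (suc n) f ≡ f 0 + sumTo n (f ∘ suc)
sumTo-shift zero    f = refl
sumTo-shift (suc n) f =
  trans (cong (_+ f (suc (suc n))) (sumTo-shift n f))
        (ℤP.+-assoc (f 0) (sumTo n (f ∘ suc)) (f (suc (suc n))))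

sumTo-reverse : ∀ n (f : ℕ → ℤ) → sumTo n f ≡ sumTo n (λ k → f (n ℕ.∸ k))
sumTo-reverse zero    f = refl
sumTo-reverse (suc n) f = begin
  sumTo (suc n) f                                  ≡⟨ sumTo-shift n f ⟩
  f 0 + sumTo n (f ∘ suc)                          ≡⟨ ℤP.+-comm (f 0) _ ⟩
  sumTo n (f ∘ suc) + f 0                          ≡⟨ cong₂ _+_ (sumTo-reverse n (f ∘ suc))
                                                               (cong f (sym (ℕP.n∸n≡0 n))) ⟩
  sumTo n (λ k → f (suc (n ℕ.∸ k))) + f (n ℕ.∸ n)  ≡⟨ cong (_+ f (n ℕ.∸ n)) (sumTo-cong≤ n
                                                        (λ k k≤n → cong f (sym (ℕP.+-∸-assoc 1 k≤n)))) ⟩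
  sumTo (suc n) (λ k → f (suc n ℕ.∸ k))            ∎

sumTo-zero : ∀ n (f : ℕ → ℤ) → (∀ k → k ≤ n → f k ≡ + 0) → sumTo n f ≡ + 0
sumTo-zero n f f≡0 = trans (sumTo-cong≤ n f≡0) (sumTo-const0 n)
  where
  sumTo-const0 : ∀ n → sumTo n (λ _ → + 0) ≡ + 0
  sumTo-const0 zero    = refl
  sumTo-const0 (suc n) = cong (_+ + 0) (sumTo-const0 n)

sumTo-single : ∀ n (f : ℕ → ℤ) {i} → i ≤ n →
  (∀ k → k ≤ n → k ≢ i → f k ≡ + 0) → sumTo n f ≡ f i
sumTo-single zero    f z≤n _ = refl
sumTo-single (suc n) f {i} i≤1+n others with suc n ℕ.≟ i
... | yes refl =
  trans (cong (_+ f (suc n)) (sumTo-zero n f (λ k k≤n → others k (ℕP.m≤n⇒m≤1+n k≤n)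
                                                   (λ { refl → ℕP.<-irrefl refl (s≤s k≤n) }))))
        (ℤP.+-identityˡ (f (suc n)))
... | no 1+n≢i =
  trans (cong₂ _+_ (sumTo-single n f i≤n (λ k k≤n → others k (ℕP.m≤n⇒m≤1+n k≤n)))
                   (others (suc n) ℕP.≤-refl 1+n≢i))
        (ℤP.+-identityʳ (f i))
  where
  i≤n : i ≤ n
  i≤n = ℕP.m<1+n⇒m≤n (ℕP.≤∧≢⇒< i≤1+n (λ i≡1+n → 1+n≢i (sym i≡1+n)))

sumFrom1-as-sumTo : ∀ m (f : ℕ → ℤ) → sumFrom1 (suc m) f ≡ sumTo m (f ∘ suc)
sumFrom1-as-sumTo zero    f = ℤP.+-identityˡ (f 1)
sumFrom1-as-sumTo (suc m) f = cong (_+ f (suc (suc m))) (sumFrom1-as-sumTo m f)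

-- Signs and binomial coefficients.

sign-+ : ∀ j k → sign (j ℕ.+ k) ≡ sign j * sign k
sign-+ zero    k = sym (ℤP.*-identityˡ (sign k))
sign-+ (suc j) k = trans (cong -_ (sign-+ j k)) (ℤP.neg-distribˡ-* (sign j) (sign k))

sign-square : ∀ j → sign j * sign j ≡ + 1
sign-square zero    = refl
sign-square (suc j) = trans (neg-square (sign j)) (sign-square j)
  where
  neg-square : ∀ a → (- a) * (- a) ≡ a * a
  neg-square = solve-∀

-- (-1)^(n-j) = (-1)^n (-1)^j, because (-1)^j is its own inverse.
sign-∸ : ∀ {j n} → j ≤ n → sign (n ℕ.∸ j) ≡ sign n * sign j
sign-∸ {j} {n} j≤n = sym (begin
  sign n * sign j                         ≡⟨ cong (λ t → sign t * sign j) (sym (ℕP.m∸n+n≡m j≤n)) ⟩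
  sign (n ℕ.∸ j ℕ.+ j) * sign j           ≡⟨ cong (_* sign j) (sign-+ (n ℕ.∸ j) j) ⟩
  sign (n ℕ.∸ j) * sign j * sign j        ≡⟨ ℤP.*-assoc (sign (n ℕ.∸ j)) (sign j) (sign j) ⟩
  sign (n ℕ.∸ j) * (sign j * sign j)      ≡⟨ cong (sign (n ℕ.∸ j) *_) (sign-square j) ⟩
  sign (n ℕ.∸ j) * + 1                    ≡⟨ ℤP.*-identityʳ (sign (n ℕ.∸ j)) ⟩
  sign (n ℕ.∸ j)                          ∎)

alt : ℕ → ℕ → ℤ
alt n k = sign k * + (n C k)

alt-reflect : ∀ {n j} → j ≤ n → alt n (n ℕ.∸ j) ≡ sign n * alt n j
alt-reflect {n} {j} j≤n = begin
  sign (n ℕ.∸ j) * + (n C (n ℕ.∸ j)) ≡⟨ cong₂ (λ a b → a * + b) (sign-∸ j≤n) (sym (nCk≡nC[n∸k] j≤n)) ⟩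
  sign n * sign j * + (n C j)        ≡⟨ ℤP.*-assoc (sign n) (sign j) (+ (n C j)) ⟩
  sign n * alt n j                   ∎

-- The Vandermonde convolution.

binom : ℕ → (ℕ → ℤ) → ℤ
binom n f = sumTo n (λ t → f t * + (n C t))

-- Pascal's rule, summed:  binom (a+1) g = binom a g + binom a (g ∘ suc).
binom-pascal : ∀ a (g : ℕ → ℤ) → binom (suc a) g ≡ binom a g + binom a (g ∘ suc)
binom-pascal a g = begin
  binom (suc a) g
    ≡⟨ sumTo-shift a _ ⟩
  g 0 * + 1 + sumTo a (λ j → g (suc j) * + (suc a C suc j))
    ≡⟨ cong (λ z → g 0 * + 1 + z) (trans (sumTo-cong a pascal) (sumTo-+ a _ _)) ⟩
  g 0 * + 1 + (binom a (g ∘ suc) + upper)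
    ≡⟨ regroup (g 0 * + 1) (binom a (g ∘ suc)) upper ⟩
  (g 0 * + 1 + upper) + binom a (g ∘ suc)
    ≡⟨ cong (_+ binom a (g ∘ suc)) (sym (sumTo-shift a (λ j → g j * + (a C j)))) ⟩
  sumTo (suc a) (λ j → g j * + (a C j)) + binom a (g ∘ suc)
    ≡⟨ cong (λ c → binom a g + g (suc a) * + c + binom a (g ∘ suc)) (k>n⇒nCk≡0 (ℕP.n<1+n a)) ⟩
  binom a g + g (suc a) * + 0 + binom a (g ∘ suc)
    ≡⟨ cong (λ z → binom a g + z + binom a (g ∘ suc)) (ℤP.*-zeroʳ (g (suc a))) ⟩
  binom a g + + 0 + binom a (g ∘ suc)
    ≡⟨ cong (_+ binom a (g ∘ suc)) (ℤP.+-identityʳ (binom a g)) ⟩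
  binom a g + binom a (g ∘ suc) ∎
  where
  upper : ℤ
  upper = sumTo a (λ j → g (suc j) * + (a C suc j))
  pascal : ∀ j → g (suc j) * + (suc a C suc j) ≡ g (suc j) * + (a C j) + g (suc j) * + (a C suc j)
  pascal j = trans (cong (λ c → g (suc j) * + c) (sym (nCk+nC[k+1]≡[n+1]C[k+1] a j)))
                   (trans (cong (g (suc j) *_) (ℤP.pos-+ (a C j) (a C suc j)))
                          (ℤP.*-distribˡ-+ (g (suc j)) _ _))
  regroup : ∀ x y z → x + (y + z) ≡ (x + z) + y
  regroup = solve-∀

vandermonde : ∀ a b (f : ℕ → ℤ) →
  binom a (λ j → binom b (λ k → f (j ℕ.+ k))) ≡ binom (a ℕ.+ b) f
vandermonde zero    b f = ℤP.*-identityʳ (binom b f)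
vandermonde (suc a) b f = begin
  binom (suc a) inner                                   ≡⟨ binom-pascal a inner ⟩
  binom a inner + binom a (inner ∘ suc)                 ≡⟨ cong₂ _+_ (vandermonde a b f)
                                                                     (vandermonde a b (f ∘ suc)) ⟩
  binom (a ℕ.+ b) f + binom (a ℕ.+ b) (f ∘ suc)         ≡⟨ binom-pascal (a ℕ.+ b) f ⟨
  binom (suc a ℕ.+ b) f                                 ∎
  where
  inner : ℕ → ℤ
  inner j = binom b (λ k → f (j ℕ.+ k))

-- Divisibility indicators modulo a positive modulus M = (m-1) + 1.

indicator : {P : Set} → Dec P → ℤ
indicator (yes _) = + 1
indicator (no _)  = + 0

module Residues (m-1 : ℕ) where

  M : ℕ
  M = suc m-1

  -- δ x = [M ∣ x], decided through the remainder exactly as in the definition of T*.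
  δ : ℤ → ℤ
  δ x = indicator (x %ℕ M ℕ.≟ 0)

  below-multiple : ∀ {d} → d < M → M ℕD.∣ d → d ≡ 0
  below-multiple {d} d<M M∣d = trans (sym (m<n⇒m%n≡m d<M)) (ℕD.n∣m⇒m%n≡0 d M M∣d)

  %ℕ≡0⇒∣ : ∀ x → x %ℕ M ≡ 0 → + M ∣ x
  %ℕ≡0⇒∣ x rem≡0 = divides (x /ℕ M) (begin
    x                              ≡⟨ a≡a%ℕn+[a/ℕn]*n x M ⟩
    + (x %ℕ M) + (x /ℕ M) * + M    ≡⟨ cong (λ r → + r + (x /ℕ M) * + M) rem≡0 ⟩
    + 0 + (x /ℕ M) * + M           ≡⟨ ℤP.+-identityˡ _ ⟩
    (x /ℕ M) * + M                 ∎)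

  ∣⇒%ℕ≡0 : ∀ x → + M ∣ x → x %ℕ M ≡ 0
  ∣⇒%ℕ≡0 x M∣x = below-multiple (n%ℕd<d x M) (∣⇒∣ᵤ M∣remainder)
    where
    cancel : ∀ r q → (r + q) - q ≡ r
    cancel = solve-∀
    remainder : x - (x /ℕ M) * + M ≡ + (x %ℕ M)
    remainder = trans (cong (_- (x /ℕ M) * + M) (a≡a%ℕn+[a/ℕn]*n x M))
                      (cancel (+ (x %ℕ M)) ((x /ℕ M) * + M))
    M∣remainder : + M ∣ + (x %ℕ M)
    M∣remainder = subst (+ M ∣_) remainder (∣m∣n⇒∣m-n M∣x (∣n⇒∣m*n (x /ℕ M) ∣-refl))

  δ-yes : ∀ x → + M ∣ x → δ x ≡ + 1
  δ-yes x M∣x with x %ℕ M ℕ.≟ 0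
  ... | yes _     = refl
  ... | no rem≢0  = ⊥-elim (rem≢0 (∣⇒%ℕ≡0 x M∣x))

  δ-no : ∀ x → ¬ (+ M ∣ x) → δ x ≡ + 0
  δ-no x M∤x with x %ℕ M ℕ.≟ 0
  ... | yes rem≡0 = ⊥-elim (M∤x (%ℕ≡0⇒∣ x rem≡0))
  ... | no _      = refl

  δ-cong : ∀ x y → + M ∣ (x - y) → δ x ≡ δ y
  δ-cong x y M∣x-y with + M ∣? y
  ... | yes M∣y = trans (δ-yes x (subst (+ M ∣_) (x-y+y≡x x y) (∣m∣n⇒∣m+n M∣x-y M∣y))) (sym (δ-yes y M∣y))
    where
    x-y+y≡x : ∀ x y → (x - y) + y ≡ x
    x-y+y≡x = solve-∀
  ... | no M∤y  = trans (δ-no x (λ M∣x → M∤y (subst (+ M ∣_) (x-[x-y]≡y x y) (∣m∣n⇒∣m-n M∣x M∣x-y))))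
                        (sym (δ-no y M∤y))
    where
    x-[x-y]≡y : ∀ x y → x - (x - y) ≡ y
    x-[x-y]≡y = solve-∀

  δ-gate : ∀ u v w → (+ M ∣ u → + M ∣ (v - w)) → δ u * δ v ≡ δ u * δ w
  δ-gate u v w M∣v-w with + M ∣? u
  ... | yes M∣u = cong (δ u *_) (δ-cong v w (M∣v-w M∣u))
  ... | no M∤u  = trans (cong (_* δ v) (δ-no u M∤u)) (cong (_* δ w) (sym (δ-no u M∤u)))

  residue-unique : ∀ {i j} → i < M → j < M → + M ∣ (+ i - + j) → i ≡ j
  residue-unique {i} {j} i<M j<M M∣i-j =
    ℤP.+-injective (ℤP.i-j≡0⇒i≡j (+ i) (+ j) (ℤP.∣i∣≡0⇒i≡0 (below-multiple distance<M (∣⇒∣ᵤ M∣i-j))))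
    where
    distance<M : ∣ + i - + j ∣ < M
    distance<M = subst (_< M) (cong ∣_∣ (sym (ℤP.m-n≡m⊖n i j)))
                       (ℕP.≤-<-trans (ℤP.∣m⊝n∣≤m⊔n i j) (ℕP.⊔-lub i<M j<M))

  -- Every integer x is congruent to 1 + residue x, with residue x < M.
  residue : ℤ → ℕ
  residue x = (x - + 1) %ℕ M

  residue-divides : ∀ x → + M ∣ (x - + suc (residue x))
  residue-divides x = divides q (begin
    x - (+ 1 + + r)                 ≡⟨ split x (+ 1) (+ r) ⟩
    (x - + 1) - + r                 ≡⟨ cong (_- + r) (a≡a%ℕn+[a/ℕn]*n (x - + 1) M) ⟩
    (+ r + q * + M) - + r           ≡⟨ cancel (+ r) (q * + M) ⟩
    q * + M                         ∎)
    where
    r : ℕ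
    r = residue x
    q : ℤ
    q = (x - + 1) /ℕ M
    split : ∀ x a b → x - (a + b) ≡ (x - a) - b
    split = solve-∀
    cancel : ∀ r t → (r + t) - r ≡ t
    cancel = solve-∀

  residue-sum : ∀ x → sumTo m-1 (λ i → δ (x - + suc i)) ≡ + 1
  residue-sum x =
    trans (sumTo-single m-1 (λ i → δ (x - + suc i)) (ℕP.≤-pred (n%ℕd<d (x - + 1) M)) others)
          (δ-yes _ (residue-divides x))
    where
    difference : ∀ x i r → (x - (+ 1 + r)) - (x - (+ 1 + i)) ≡ i - r
    difference = solve-∀
    others : ∀ i → i ≤ m-1 → i ≢ residue x → δ (x - + suc i) ≡ + 0
    others i i≤m-1 i≢r = δ-no _ λ M∣x-1-i → i≢r (residue-unique (s≤s i≤m-1) (n%ℕd<d (x - + 1) M)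
      (subst (+ M ∣_) (difference x (+ i) (+ residue x))
             (∣m∣n⇒∣m-n (residue-divides x) M∣x-1-i)))

  orthogonality : ∀ x y s →
    sumTo m-1 (λ i → δ (x - + suc i) * δ (y - (+ suc i + s))) ≡ δ (y - (x + s))
  orthogonality x y s = begin
    sumTo m-1 (λ i → δ (x - + suc i) * δ (y - (+ suc i + s)))
      ≡⟨ sumTo-cong m-1 (λ i → δ-gate (x - + suc i) (y - (+ suc i + s)) (y - (x + s))
                                      (subst (+ M ∣_) (difference x y s (+ suc i)))) ⟩
    sumTo m-1 (λ i → δ (x - + suc i) * δ (y - (x + s)))
      ≡⟨ sumTo-*ʳ m-1 (δ (y - (x + s))) (λ i → δ (x - + suc i)) ⟩
    sumTo m-1 (λ i → δ (x - + suc i)) * δ (y - (x + s))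
      ≡⟨ cong (_* δ (y - (x + s))) (residue-sum x) ⟩
    + 1 * δ (y - (x + s))
      ≡⟨ ℤP.*-identityˡ _ ⟩
    δ (y - (x + s)) ∎
    where
    difference : ∀ x y s r → x - r ≡ (y - (r + s)) - (y - (x + s))
    difference = solve-∀

  correlation : ∀ n p s (u v : ℕ → ℤ) →
    sumTo m-1 (λ i → sumTo n (λ j → δ (+ j - + suc i) * u j)
                 * sumTo p (λ k → δ (+ k - (+ suc i + s)) * v k))
    ≡ sumTo n (λ j → sumTo p (λ k → u j * v k * δ (+ k - (+ j + s))))
  correlation n p s u v = begin
    sumTo m-1 (λ i → sumTo n (λ j → δ (+ j - + suc i) * u j)
                 * sumTo p (λ k → δ (+ k - (+ suc i + s)) * v k))
      ≡⟨ sumTo-cong m-1 (λ i → sumTo-product n p _ _) ⟩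
    sumTo m-1 (λ i → sumTo n (λ j → sumTo p (λ k → term i j k)))
      ≡⟨ sumTo-swap m-1 n _ ⟩
    sumTo n (λ j → sumTo m-1 (λ i → sumTo p (λ k → term i j k)))
      ≡⟨ sumTo-cong n (λ j → sumTo-swap m-1 p _) ⟩
    sumTo n (λ j → sumTo p (λ k → sumTo m-1 (λ i → term i j k)))
      ≡⟨ sumTo-cong n (λ j → sumTo-cong p (λ k → collect j k)) ⟩
    sumTo n (λ j → sumTo p (λ k → u j * v k * δ (+ k - (+ j + s)))) ∎
    where
    term : ℕ → ℕ → ℕ → ℤ
    term i j k = δ (+ j - + suc i) * u j * (δ (+ k - (+ suc i + s)) * v k)
    rearrange : ∀ a b c d → a * b * (c * d) ≡ b * d * (a * c)
    rearrange = solve-∀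
    collect : ∀ j k → sumTo m-1 (λ i → term i j k) ≡ u j * v k * δ (+ k - (+ j + s))
    collect j k = begin
      sumTo m-1 (λ i → term i j k)
        ≡⟨ sumTo-cong m-1 (λ i → rearrange (δ (+ j - + suc i)) (u j) (δ (+ k - (+ suc i + s))) (v k)) ⟩
      sumTo m-1 (λ i → u j * v k * (δ (+ j - + suc i) * δ (+ k - (+ suc i + s))))
        ≡⟨ sumTo-*ˡ m-1 (u j * v k) _ ⟩
      u j * v k * sumTo m-1 (λ i → δ (+ j - + suc i) * δ (+ k - (+ suc i + s)))
        ≡⟨ cong (u j * v k *_) (orthogonality (+ j) (+ k) s) ⟩
      u j * v k * δ (+ k - (+ j + s)) ∎

  -- The summand of T* is only accessible through its unfolding, so its
  -- evaluation is declared first (with the summand left to unification) and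
  -- proved after its use.
  Tstar-summand : ∀ r n k → _ ≡ indicator (congDec M k r) * alt n k

  Tstar-as-classSum : ∀ r n → Tstar r M n ≡ sumTo n (λ k → δ (+ k - r) * alt n k)
  Tstar-as-classSum r n = sumTo-cong n (Tstar-summand r n)

  Tstar-summand r n k with congDec M k r
  ... | yes _ = sym (ℤP.*-identityˡ (alt n k))
  ... | no _  = refl

  Tstar-as-binom : ∀ r n → Tstar r M n ≡ binom n (λ t → sign t * δ (+ t - r))
  Tstar-as-binom r n = trans (Tstar-as-classSum r n) (sumTo-cong n reassociate)
    where
    swap-first : ∀ d a c → d * (a * c) ≡ a * d * c
    swap-first = solve-∀
    reassociate : ∀ t → δ (+ t - r) * alt n t ≡ sign t * δ (+ t - r) * + (n C t)
    reassociate t = swap-first (δ (+ t - r)) (sign t) (+ (n C t))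

  -- The sequence f t = (-1)^t [t ≡ n + s] that the Vandermonde convolution is applied to.
  signedClass : ℕ → ℤ → ℕ → ℤ
  signedClass n s t = sign t * δ (+ t - (+ n + s))

  reflected-summand : ∀ {n j} s k → j ≤ n →
    alt n (n ℕ.∸ j) * alt n k * δ (+ k - (+ (n ℕ.∸ j) + s))
    ≡ sign n * (signedClass n s (j ℕ.+ k) * + (n C k) * + (n C j))
  reflected-summand {n} {j} s k j≤n = begin
    alt n (n ℕ.∸ j) * alt n k * δ (+ k - (+ (n ℕ.∸ j) + s))
      ≡⟨ cong₂ (λ a z → a * alt n k * δ z) (alt-reflect j≤n) shifted-index ⟩
    sign n * (sign j * + (n C j)) * (sign k * + (n C k)) * δ (+ (j ℕ.+ k) - (+ n + s))
      ≡⟨ rearrange (sign n) (sign j) (+ (n C j)) (sign k) (+ (n C k)) _ ⟩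
    sign n * (sign j * sign k * δ (+ (j ℕ.+ k) - (+ n + s)) * + (n C k) * + (n C j))
      ≡⟨ cong (λ σ → sign n * (σ * δ (+ (j ℕ.+ k) - (+ n + s)) * + (n C k) * + (n C j)))
              (sym (sign-+ j k)) ⟩
    sign n * (signedClass n s (j ℕ.+ k) * + (n C k) * + (n C j)) ∎
    where
    index : ∀ k n j s → k - ((n - j) + s) ≡ (j + k) - (n + s)
    index = solve-∀
    rearrange : ∀ σ a b c d z → σ * (a * b) * (c * d) * z ≡ σ * (a * c * z * d * b)
    rearrange = solve-∀
    shifted-index : + k - (+ (n ℕ.∸ j) + s) ≡ + (j ℕ.+ k) - (+ n + s)
    shifted-index = begin
      + k - (+ (n ℕ.∸ j) + s)   ≡⟨ cong (λ w → + k - (w + s)) (sym (ℤP.⊖-≥ j≤n)) ⟩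
      + k - ((n ⊖ j) + s)       ≡⟨ cong (λ w → + k - (w + s)) (sym (ℤP.m-n≡m⊖n n j)) ⟩
      + k - ((+ n - + j) + s)   ≡⟨ index (+ k) (+ n) (+ j) s ⟩
      (+ j + + k) - (+ n + s)   ∎

  reflection : ∀ n s →
    sumTo n (λ j → sumTo n (λ k → alt n j * alt n k * δ (+ k - (+ j + s))))
    ≡ sign n * binom n (λ j → binom n (λ k → signedClass n s (j ℕ.+ k)))
  reflection n s = begin
    sumTo n row                          ≡⟨ sumTo-reverse n row ⟩
    sumTo n (λ j → row (n ℕ.∸ j))        ≡⟨ sumTo-cong≤ n reflected-row ⟩
    sumTo n (λ j → sign n * (binom n (λ k → f (j ℕ.+ k)) * + (n C j)))
                                         ≡⟨ sumTo-*ˡ n (sign n) _ ⟩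
    sign n * binom n (λ j → binom n (λ k → f (j ℕ.+ k))) ∎
    where
    f : ℕ → ℤ
    f = signedClass n s
    row : ℕ → ℤ
    row j = sumTo n (λ k → alt n j * alt n k * δ (+ k - (+ j + s)))
    reflected-row : ∀ j → j ≤ n → row (n ℕ.∸ j) ≡ sign n * (binom n (λ k → f (j ℕ.+ k)) * + (n C j))
    reflected-row j j≤n = begin
      row (n ℕ.∸ j)
        ≡⟨ sumTo-cong n (λ k → reflected-summand s k j≤n) ⟩
      sumTo n (λ k → sign n * (f (j ℕ.+ k) * + (n C k) * + (n C j)))
        ≡⟨ sumTo-*ˡ n (sign n) _ ⟩
      sign n * sumTo n (λ k → f (j ℕ.+ k) * + (n C k) * + (n C j))
        ≡⟨ cong (sign n *_) (sumTo-*ʳ n (+ (n C j)) _) ⟩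
      sign n * (binom n (λ k → f (j ℕ.+ k)) * + (n C j)) ∎

lemma2p2 : (m : ℕ) .{{_ : NonZero m}} (n : ℕ) (s : ℤ) →
    sumFrom1 m (λ r → Tstar (+ r) m n * Tstar (+ r + s) m n)
      ≡ sign n * Tstar (+ n + s) m (n Data.Nat.+ n)
lemma2p2 (suc m-1) n s = begin
  sumFrom1 M (λ r → Tstar (+ r) M n * Tstar (+ r + s) M n)
    ≡⟨ sumFrom1-as-sumTo m-1 _ ⟩
  sumTo m-1 (λ i → Tstar (+ suc i) M n * Tstar (+ suc i + s) M n)
    ≡⟨ sumTo-cong m-1 (λ i → cong₂ _*_ (Tstar-as-classSum (+ suc i) n)
                                     (Tstar-as-classSum (+ suc i + s) n)) ⟩
  sumTo m-1 (λ i → sumTo n (λ j → δ (+ j - + suc i) * alt n j)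
               * sumTo n (λ k → δ (+ k - (+ suc i + s)) * alt n k))
    ≡⟨ correlation n n s (alt n) (alt n) ⟩
  sumTo n (λ j → sumTo n (λ k → alt n j * alt n k * δ (+ k - (+ j + s))))
    ≡⟨ reflection n s ⟩
  sign n * binom n (λ j → binom n (λ k → signedClass n s (j ℕ.+ k)))
    ≡⟨ cong (sign n *_) (vandermonde n n (signedClass n s)) ⟩
  sign n * binom (n ℕ.+ n) (signedClass n s)
    ≡⟨ cong (sign n *_) (Tstar-as-binom (+ n + s) (n ℕ.+ n)) ⟨
  sign n * Tstar (+ n + s) M (n ℕ.+ n) ∎
  where open Residues m-1
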